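{- Assume that $d_n^2 < 2p_n$ for every integer $n\geq 1$ with $n\neq 4$. Then for every $n\geq 1$, $d_n = \lfloor 2\sqrt{p_{n+1}}\,\Delta_n\rfloor$. Moreover, for every $n>1$, the integer $\lfloor 2\sqrt{p_n}\,\Delta_n\rfloor$ is odd and $d_n = \lfloor 2\sqrt{p_n}\,\Delta_n\rfloor + 1$.
   Context: $p_n$ denotes the $n$th prime ($p_1=2$), $d_n := p_{n+1}-p_n$, and $\Delta_n := \sqrt{p_{n+1}}-\sqrt{p_n}$. $\lfloor x\rfloor$ is the integer part of $x$. -}

module Defs where

open import Data.Nat as ℕ using (ℕ; suc)
open import Data.Nat.Primality using (Prime; prime?)
open import Data.List using (length; filter; upTo)
open import Data.Integer as ℤ using (ℤ; +_; ∣_∣)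
open import Data.Product using (Σ; _×_)
open import Data.Sum using (_⊎_)
open import Relation.Binary.PropositionalEquality using (_≡_)

primesBelow : ℕ → ℕ
primesBelow m = length (filter prime? (upTo m))

-- NthPrime n p  :  p = p_n  (1-indexed, p_1 = 2)
NthPrime : ℕ → ℕ → Set
NthPrime n p = Prime p × suc (primesBelow p) ≡ n

-- Exact comparisons between an integer t and the real number √M (M : ℕ)
_≤√_ : ℤ → ℕ → Set
t ≤√ M = (t ℤ.≤ + 0) ⊎ (∣ t ∣ ℕ.* ∣ t ∣ ℕ.≤ M)

_<√_ : ℤ → ℕ → Set
t <√ M = (t ℤ.< + 0) ⊎ (∣ t ∣ ℕ.* ∣ t ∣ ℕ.< M)

_√≤_ : ℕ → ℤ → Set
M √≤ t = (+ 0 ℤ.≤ t) × (M ℕ.≤ ∣ t ∣ ℕ.* ∣ t ∣)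

_√<_ : ℕ → ℤ → Set
M √< t = (+ 0 ℤ.< t) × (M ℕ.< ∣ t ∣ ℕ.* ∣ t ∣)

-- k = ⌊ √M - c ⌋   i.e.  k ≤ √M - c < k + 1
IsFloorSqrtMinus : ℤ → ℕ → ℤ → Set
IsFloorSqrtMinus k M c = ((k ℤ.+ c) ≤√ M) × (M √< (k ℤ.+ c ℤ.+ + 1))

-- k = ⌊ c - √M ⌋   i.e.  k ≤ c - √M < k + 1
IsFloorMinusSqrt : ℤ → ℤ → ℕ → Set
IsFloorMinusSqrt k c M = (M √≤ (c ℤ.- k)) × ((c ℤ.- k ℤ.- + 1) <√ M)

OddInt : ℤ → Set
OddInt k = Σ ℤ (λ j → k ≡ + 2 ℤ.* j ℤ.+ + 1)

-- Write q = p + d. Since 4pq = (p + q)² − d², the number √(4pq) lies strictly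
-- between p + q − 1 and p + q as soon as (d − 1)² < 4p, and then
-- ⌊2q − √(4pq)⌋ = d and ⌊√(4pq) − 2p⌋ = d − 1. The bound (d − 1)² < 4p follows
-- from d² < 2p, and for the excluded pair (p₄, p₅) = (7, 11) from counting primes.
-- For n > 1 both primes are odd, so d is even and d − 1 is odd.

module Submission where

open import Defs
open import Data.Nat
  using (ℕ; suc; _*_; _∸_; _<_; _≤_; _+_; _≤′_; ≤′-refl; ≤′-step; z≤n; z<s; s≤s⁻¹; _≟_; nonTrivial⇒n>1)
open import Data.Nat.Properties
open import Data.Nat.Primality using (Prime; prime?; prime⇒irreducible; prime⇒nonTrivial)
open import Data.Nat.Divisibility using (_∣_; divides)
open import Data.Nat.Tactic.RingSolver using (solve-∀)
open import Data.Integer as ℤ using (+_; +≤+; +<+)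
open import Data.Integer.Properties using (+-0-abelianGroup; pos-*)
open import Algebra.Properties.AbelianGroup +-0-abelianGroup using (//-rightDividesʳ)
open import Data.List using (length; filter; upTo; _++_; _∷ʳ_; [_])
open import Data.List.Properties using (upTo-∷ʳ; length-++-≤ˡ; filter-++)
open import Data.Product using (Σ; ∃; _×_; _,_; proj₁)
open import Data.Sum using (inj₁; inj₂)
open import Relation.Nullary using (yes; no; contradiction)
open import Relation.Binary.PropositionalEquality
  using (_≡_; _≢_; refl; sym; cong; subst; module ≡-Reasoning)

primesBelow-≤-suc : ∀ m → primesBelow m ≤ primesBelow (suc m)
primesBelow-≤-suc m = begin
  length (filter prime? (upTo m))                        ≤⟨ length-++-≤ˡ (filter prime? (upTo m)) ⟩
  length (filter prime? (upTo m) ++ filter prime? [ m ]) ≡⟨ cong length (filter-++ prime? (upTo m) [ m ]) ⟨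
  length (filter prime? (upTo m ∷ʳ m))                   ≡⟨ cong (λ ms → length (filter prime? ms)) (upTo-∷ʳ m) ⟩
  length (filter prime? (upTo (suc m)))                  ∎
  where open ≤-Reasoning

primesBelow-mono-≤ : ∀ {m n} → m ≤ n → primesBelow m ≤ primesBelow n
primesBelow-mono-≤ m≤n = mono′ (≤⇒≤′ m≤n)
  where
  mono′ : ∀ {m n} → m ≤′ n → primesBelow m ≤ primesBelow n
  mono′ ≤′-refl              = ≤-refl
  mono′ (≤′-step {n} m≤′n) = ≤-trans (mono′ m≤′n) (primesBelow-≤-suc n)

primesBelow-cancel-< : ∀ {m n} → primesBelow m < primesBelow n → m < n
primesBelow-cancel-< pb[m]<pb[n] = ≰⇒> λ n≤m → <⇒≱ pb[m]<pb[n] (primesBelow-mono-≤ n≤m)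

NthPrime-< : ∀ {n p q} → NthPrime n p → NthPrime (suc n) q → p < q
NthPrime-< (_ , refl) (_ , pb[q]+1≡pb[p]+2) =
  primesBelow-cancel-< (≤-reflexive (sym (suc-injective pb[q]+1≡pb[p]+2)))

NthPrime⇒≢2 : ∀ {n p} → 1 < n → NthPrime n p → p ≢ 2
NthPrime⇒≢2 1<n (_ , refl) refl = <-irrefl refl 1<n

prime⇒≥2 : ∀ {p} → Prime p → 2 ≤ p
prime⇒≥2 {p} p-prime = nonTrivial⇒n>1 p {{prime⇒nonTrivial p-prime}}

prime∧2∣⇒≡2 : ∀ {p} → Prime p → 2 ∣ p → p ≡ 2
prime∧2∣⇒≡2 p-prime 2∣p with prime⇒irreducible p-prime 2∣p
... | inj₁ ()
... | inj₂ 2≡p = sym 2≡p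

data Parity : ℕ → Set where
  even : ∀ j → Parity (j * 2)
  odd  : ∀ j → Parity (1 + j * 2)

parity : ∀ m → Parity m
parity 0 = even 0
parity (suc m) with parity m
... | even j = odd j
... | odd j  = even (suc j)

OddInt-odd : ∀ j → OddInt (+ (1 + j * 2))
OddInt-odd j = + j , (begin
  + (1 + j * 2)       ≡⟨ cong +_ (+-comm 1 (j * 2)) ⟩
  + (j * 2 + 1)       ≡⟨ cong (λ m → + (m + 1)) (*-comm j 2) ⟩
  + (2 * j) ℤ.+ + 1   ≡⟨ cong (ℤ._+ + 1) (pos-* 2 j) ⟩
  + 2 ℤ.* + j ℤ.+ + 1 ∎)
  where open ≡-Reasoning

odd+odd≡even : ∀ j i → 1 + j * 2 + (1 + i * 2) ≡ suc (j + i) * 2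
odd+odd≡even = solve-∀

OddInt-gap-pred : ∀ {p e} → Prime p → Prime (p + suc e) → p ≢ 2 → OddInt (+ e)
OddInt-gap-pred {p} {e} p-prime q-prime p≢2 with parity p | parity e
... | even j | _      = contradiction (prime∧2∣⇒≡2 p-prime (divides j refl)) p≢2
... | odd j  | odd i  = OddInt-odd i
... | odd j  | even i =
  contradiction (prime∧2∣⇒≡2 q-prime (divides (suc (j + i)) (odd+odd≡even j i))) q≢2
  where
  q≢2 : 1 + j * 2 + (1 + i * 2) ≢ 2
  q≢2 = >⇒≢ (≤-<-trans (prime⇒≥2 p-prime) (m<m+n (1 + j * 2) z<s))

[e+2p]²<4p[p+1+e] : ∀ p e → e * e < 4 * p → (e + 2 * p) * (e + 2 * p) < 4 * p * (p + suc e)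
[e+2p]²<4p[p+1+e] p e e²<4p = +-cancelʳ-< (4 * p) _ _ (begin-strict
  (e + 2 * p) * (e + 2 * p) + 4 * p ≡⟨ identity p e ⟩
  4 * p * (p + suc e) + e * e       <⟨ +-monoʳ-< (4 * p * (p + suc e)) e²<4p ⟩
  4 * p * (p + suc e) + 4 * p       ∎)
  where
  open ≤-Reasoning
  identity : ∀ p e → (e + 2 * p) * (e + 2 * p) + 4 * p ≡ 4 * p * (p + suc e) + e * e
  identity = solve-∀

4p[p+1+e]<[e+2p+1]² : ∀ p e → 4 * p * (p + suc e) < (e + 2 * p + 1) * (e + 2 * p + 1)
4p[p+1+e]<[e+2p+1]² p e = begin-strict
  4 * p * (p + suc e)                 <⟨ m<m+n (4 * p * (p + suc e)) z<s ⟩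
  4 * p * (p + suc e) + suc e * suc e ≡⟨ identity p e ⟩
  (e + 2 * p + 1) * (e + 2 * p + 1)   ∎
  where
  open ≤-Reasoning
  identity : ∀ p e → 4 * p * (p + suc e) + suc e * suc e ≡ (e + 2 * p + 1) * (e + 2 * p + 1)
  identity = solve-∀

+[m+n]-+n≡+m : ∀ m n → + (m + n) ℤ.- + n ≡ + m
+[m+n]-+n≡+m m n = //-rightDividesʳ (+ n) (+ m)

2q-[q-p]≡p+q : ∀ p e → + (2 * (p + suc e)) ℤ.- + suc e ≡ + (e + 2 * p + 1)
2q-[q-p]≡p+q p e = begin
  + (2 * (p + suc e)) ℤ.- + suc e       ≡⟨ cong (λ m → + m ℤ.- + suc e) (identity p e) ⟩
  + (e + 2 * p + 1 + suc e) ℤ.- + suc e ≡⟨ +[m+n]-+n≡+m (e + 2 * p + 1) (suc e) ⟩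
  + (e + 2 * p + 1)                     ∎
  where
  open ≡-Reasoning
  identity : ∀ p e → 2 * (p + suc e) ≡ e + 2 * p + 1 + suc e
  identity = solve-∀

⌊2q-√4pq⌋≡q-p : ∀ p e → e * e < 4 * p →
  IsFloorMinusSqrt (+ suc e) (+ (2 * (p + suc e))) (4 * p * (p + suc e))
⌊2q-√4pq⌋≡q-p p e e²<4p rewrite 2q-[q-p]≡p+q p e | +[m+n]-+n≡+m (e + 2 * p) 1 =
  (+≤+ z≤n , <⇒≤ (4p[p+1+e]<[e+2p+1]² p e)) , inj₂ ([e+2p]²<4p[p+1+e] p e e²<4p)

⌊√4pq-2p⌋≡q-p-1 : ∀ p e → e * e < 4 * p → IsFloorSqrtMinus (+ e) (4 * p * (p + suc e)) (+ (2 * p))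
⌊√4pq-2p⌋≡q-p-1 p e e²<4p =
  inj₂ (<⇒≤ ([e+2p]²<4p[p+1+e] p e e²<4p)) , +<+ (m≤n+m 1 (e + 2 * p)) , 4p[p+1+e]<[e+2p+1]² p e

m<n⇒∃[o]m+1+o≡n : ∀ {m n} → m < n → ∃ λ o → m + suc o ≡ n
m<n⇒∃[o]m+1+o≡n {m} m<n with o , refl ← m≤n⇒∃[o]m+o≡n m<n = o , +-suc m o

[p₅-p₄-1]²<4p₄ : ∀ {p e} → NthPrime 4 p → NthPrime 5 (p + suc e) → e * e < 4 * p
[p₅-p₄-1]²<4p₄ {p} {e} (_ , pb[p]+1≡4) (_ , pb[q]+1≡5) = begin-strict
  e * e ≤⟨ *-mono-≤ e≤4 e≤4 ⟩
  16    <⟨ m≤m+n 17 7 ⟩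
  4 * 6 ≤⟨ *-monoʳ-≤ 4 6≤p ⟩
  4 * p ∎
  where
  open ≤-Reasoning
  -- primesBelow 5 and primesBelow 12 compute to 2 and 5.
  6≤p : 6 ≤ p
  6≤p = primesBelow-cancel-< {5} (subst (2 <_) (sym (suc-injective pb[p]+1≡4)) ≤-refl)
  q<12 : p + suc e < 12
  q<12 = primesBelow-cancel-< {n = 12} (subst (_< 5) (sym (suc-injective pb[q]+1≡5)) ≤-refl)
  e≤4 : e ≤ 4
  e≤4 = s≤s⁻¹ (+-cancelˡ-≤ 7 (suc e) 5 (≤-<-trans (+-monoˡ-≤ (suc e) 6≤p) q<12))

SmallGaps : Set
SmallGaps = ∀ n p q → 1 ≤ n → n ≢ 4 → NthPrime n p → NthPrime (suc n) q → (q ∸ p) * (q ∸ p) < 2 * p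

SmallGaps⇒[gap-1]²<4p : SmallGaps → ∀ {n p e} → 1 ≤ n → NthPrime n p → NthPrime (suc n) (p + suc e) →
  e * e < 4 * p
SmallGaps⇒[gap-1]²<4p small-gaps {n} {p} {e} 1≤n pₙ pₙ₊₁ with n ≟ 4
... | yes refl = [p₅-p₄-1]²<4p₄ pₙ pₙ₊₁
... | no n≢4 = begin-strict
  e * e                             ≤⟨ *-mono-≤ (n≤1+n e) (n≤1+n e) ⟩
  suc e * suc e                     ≡⟨ cong (λ d → d * d) (m+n∸m≡n p (suc e)) ⟨
  (p + suc e ∸ p) * (p + suc e ∸ p) <⟨ small-gaps n p (p + suc e) 1≤n n≢4 pₙ pₙ₊₁ ⟩
  2 * p                             ≤⟨ *-monoˡ-≤ p (m≤m+n 2 2) ⟩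
  4 * p                             ∎
  where open ≤-Reasoning

proposition3p1 : (∀ n p q → 1 ≤ n → n ≢ 4 → NthPrime n p → NthPrime (suc n) q →
      (q ∸ p) * (q ∸ p) < 2 * p) →
    ∀ n p q → 1 ≤ n → NthPrime n p → NthPrime (suc n) q →
      IsFloorMinusSqrt (+ (q ∸ p)) (+ (2 * q)) (4 * p * q)
      × (1 < n →
          Σ ℤ.ℤ (λ k → IsFloorSqrtMinus k (4 * p * q) (+ (2 * p))
                        × OddInt k × (+ (q ∸ p) ≡ k ℤ.+ + 1)))
proposition3p1 small-gaps n p q 1≤n pₙ pₙ₊₁
  with e , refl ← m<n⇒∃[o]m+1+o≡n (NthPrime-< pₙ pₙ₊₁)
  rewrite m+n∸m≡n p (suc e)
  = ⌊2q-√4pq⌋≡q-p p e e²<4p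
  , λ 1<n → + e , ⌊√4pq-2p⌋≡q-p-1 p e e²<4p
                , OddInt-gap-pred (proj₁ pₙ) (proj₁ pₙ₊₁) (NthPrime⇒≢2 1<n pₙ)
                , cong +_ (+-comm 1 e)
  where
  e²<4p : e * e < 4 * p
  e²<4p = SmallGaps⇒[gap-1]²<4p small-gaps 1≤n pₙ pₙ₊₁
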